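{- Let $k\in\mathbb{N}$ and $S=\langle 4k+7,4k+9,4k+13,4k+15\rangle$. Then \[\mathrm{Ap}(S,4k+7)=\{0,\,4k+9,\,4k+13,\,4k+15,\,2(4k+9)\}\cup\{\,j(4k+15)-6,\ j(4k+15)-4,\ j(4k+15)-2,\ j(4k+15)\mid 2\le j\le k+1\,\}\cup\{(k+2)(4k+15)-6,\ (k+2)(4k+15)-4\}\] (where the middle set is empty when $k=0$).
   Context: $\mathbb{N}=\{0,1,2,\dots\}$. For $X\subseteq\mathbb{N}$, $\langle X\rangle$ is the submonoid of $(\mathbb{N},+)$ generated by $X$; here it is a numerical semigroup. For a numerical semigroup $S$ and $n\in S\setminus\{0\}$, the Apéry set is $\mathrm{Ap}(S,n)=\{s\in S\mid s-n\notin S\}$. -}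

module Defs where

open import Data.Nat using (ℕ; zero; suc; _+_; _*_; _∸_; _≤_)
open import Data.List using (List)
open import Data.List.Membership.Propositional using (_∈_)
open import Data.Product using (_×_; ∃-syntax)
open import Data.Sum using (_⊎_)
open import Relation.Nullary using (¬_)
open import Relation.Binary.PropositionalEquality using (_≡_)

data ⟨_⟩ (X : ℕ → Set) : ℕ → Set where
  zero∈ : ⟨ X ⟩ 0
  add∈  : ∀ {s g} → X g → ⟨ X ⟩ s → ⟨ X ⟩ (g + s)

-- Apéry set membership: s ∈ Ap(S,n) iff s ∈ S and s - n ∉ S
-- (s - n is an integer; if s < n it is negative and hence not in S ⊆ ℕ).
Ap : (ℕ → Set) → ℕ → ℕ → Set
Ap S n s = S s × ¬ (∃[ t ] (S t × t + n ≡ s))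

{-# OPTIONS --safe #-}
-- Write m = 4k + 7; the generators are m + 2c for the offsets c ∈ {0, 1, 3, 4}, so the elements of
-- S are the n·m + 2f with f a sum of n offsets, i.e. f ≤ 4n and (n, f) ≠ (1, 2).
-- If n·m + 2f lies in Ap(S, m) then f < m (else subtracting m leaves (n + 1)·m + 2(f − m) ∈ S) and
-- f is in the top band f ≥ 4n − 3 (else n − 1 summands already reach f), except for 2m + 4, where
-- the single remaining summand would need the offset 2. Conversely, if f < m is in the top band then
-- n·m + 2f is not t + m for any t = n'·m + 2f' ∈ S: for n' < n comparing gives f' ≥ f > 4n', and for
-- n' ≥ n it gives (n' − n + 1)·m + 2f' = 2f < 2m, impossible for odd m. Finally, f = 4n − i with
-- i ≤ 3 reads as n·m + 2f = n·(4k + 15) − 2i, and f < m forces n ≤ k + 2, with i ≥ 2 if n = k + 2.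
module Submission where

open import Defs
open import Data.Nat using (ℕ; zero; suc; _+_; _*_; _∸_; _≤_; _<_; _≤?_; _≟_; z≤n; s≤s; z<s)
open import Data.Nat.Properties
open import Data.Nat.Tactic.RingSolver using (solve-∀)
open import Data.Product using (_×_; _,_; ∃-syntax)
open import Data.Sum using (_⊎_; inj₁; inj₂)
open import Function.Bundles using (_⇔_; mk⇔)
open import Function.Properties.Equivalence using () renaming (trans to ⇔-trans)
open import Relation.Nullary using (¬_; yes; no; contradiction)
open import Relation.Nullary.Decidable using (_×-dec_)
open import Relation.Binary.PropositionalEquality
  using (_≡_; _≢_; refl; sym; trans; cong; subst; subst₂; module ≡-Reasoning)

⟨⟩-mono : ∀ {X Y : ℕ → Set} → (∀ {g} → X g → Y g) → ∀ {s} → ⟨ X ⟩ s → ⟨ Y ⟩ s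
⟨⟩-mono X⊆Y zero∈       = zero∈
⟨⟩-mono X⊆Y (add∈ x s∈) = add∈ (X⊆Y x) (⟨⟩-mono X⊆Y s∈)

Ap-transport : ∀ {X Y : ℕ → Set} → (∀ {g} → X g → Y g) → (∀ {g} → Y g → X g) →
               ∀ {n x} → Ap ⟨ X ⟩ n x → Ap ⟨ Y ⟩ n x
Ap-transport X⊆Y Y⊆X (x∈ , ∉) =
  ⟨⟩-mono X⊆Y x∈ , λ (t , t∈ , t+n≡x) → ∉ (t , ⟨⟩-mono Y⊆X t∈ , t+n≡x)

Ap-cong : ∀ {X Y : ℕ → Set} → (∀ {g} → X g → Y g) → (∀ {g} → Y g → X g) →
          ∀ {n x} → Ap ⟨ X ⟩ n x ⇔ Ap ⟨ Y ⟩ n x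
Ap-cong X⊆Y Y⊆X = mk⇔ (Ap-transport X⊆Y Y⊆X) (Ap-transport Y⊆X X⊆Y)

data Offset : ℕ → Set where
  offset0 : Offset 0
  offset1 : Offset 1
  offset3 : Offset 3
  offset4 : Offset 4

Offset⇒≤4 : ∀ {c} → Offset c → c ≤ 4
Offset⇒≤4 offset0 = z≤n
Offset⇒≤4 offset1 = s≤s z≤n
Offset⇒≤4 offset3 = s≤s (s≤s (s≤s z≤n))
Offset⇒≤4 offset4 = ≤-refl

Offset⇒≢2 : ∀ {c} → Offset c → c ≢ 2
Offset⇒≢2 offset0 ()
Offset⇒≢2 offset1 ()
Offset⇒≢2 offset3 ()
Offset⇒≢2 offset4 ()

data Gens (m : ℕ) : ℕ → Set where
  generator : ∀ {c} → Offset c → Gens m (m + 2 * c)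

-- The sums of n offsets are exactly the f ≤ 4n, except f = 2 for n = 1.
Admissible : ℕ → ℕ → Set
Admissible n f = f ≤ 4 * n × ¬ (n ≡ 1 × f ≡ 2)

record Repr (m s : ℕ) : Set where
  constructor repr
  field
    n f        : ℕ
    admissible : Admissible n f
    value      : n * m + 2 * f ≡ s

add-generator : ∀ m c n f → (m + 2 * c) + (n * m + 2 * f) ≡ suc n * m + 2 * (c + f)
add-generator = solve-∀

Admissible-add : ∀ {c n f} → Offset c → Admissible n f → Admissible (suc n) (c + f)
Admissible-add {c} {n} {f} c∈ (f≤4n , _) = c+f≤4[1+n] , c+f≢2
  where
  c+f≤4[1+n] : c + f ≤ 4 * suc n
  c+f≤4[1+n] = subst (c + f ≤_) (sym (*-suc 4 n)) (+-mono-≤ (Offset⇒≤4 c∈) f≤4n)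
  c+f≢2 : ¬ (suc n ≡ 1 × c + f ≡ 2)
  c+f≢2 (refl , c+f≡2) with n≤0⇒n≡0 f≤4n
  ... | refl = Offset⇒≢2 c∈ (trans (sym (+-identityʳ c)) c+f≡2)

⟨Gens⟩⇒Repr : ∀ {m s} → ⟨ Gens m ⟩ s → Repr m s
⟨Gens⟩⇒Repr zero∈ = repr 0 0 (z≤n , λ ()) refl
⟨Gens⟩⇒Repr {m} (add∈ (generator {c} c∈) s∈) with ⟨Gens⟩⇒Repr {m} s∈
... | repr n f adm refl =
  repr (suc n) (c + f) (Admissible-add c∈ adm) (sym (add-generator m c n f))

add-offset : ∀ {m c} n f → Offset c →
             ⟨ Gens m ⟩ (n * m + 2 * f) → ⟨ Gens m ⟩ (suc n * m + 2 * (c + f))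
add-offset {m} {c} n f c∈ s∈ = subst ⟨ Gens m ⟩ (add-generator m c n f) (add∈ (generator c∈) s∈)

≤3⇒≤4[2+p] : ∀ {p f} → f ≤ 3 → f ≤ 4 * (2 + p)
≤3⇒≤4[2+p] {p} f≤3 = ≤-trans f≤3 (≤-trans (s≤s (s≤s (s≤s z≤n))) (*-monoʳ-≤ 4 (m≤m+n 2 p)))

-- Peel off an offset 4 while f ≥ 4, else an offset 0, down to a table for two summands.
≤4*[2+p]⇒⟨Gens⟩ : ∀ {m} p f → f ≤ 4 * (2 + p) → ⟨ Gens m ⟩ ((2 + p) * m + 2 * f)
≤4*[2+p]⇒⟨Gens⟩ zero 0 _ = add-offset 1 0 offset0 (add-offset 0 0 offset0 zero∈)
≤4*[2+p]⇒⟨Gens⟩ zero 1 _ = add-offset 1 1 offset0 (add-offset 0 0 offset1 zero∈)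
≤4*[2+p]⇒⟨Gens⟩ zero 2 _ = add-offset 1 1 offset1 (add-offset 0 0 offset1 zero∈)
≤4*[2+p]⇒⟨Gens⟩ zero 3 _ = add-offset 1 3 offset0 (add-offset 0 0 offset3 zero∈)
≤4*[2+p]⇒⟨Gens⟩ zero 4 _ = add-offset 1 4 offset0 (add-offset 0 0 offset4 zero∈)
≤4*[2+p]⇒⟨Gens⟩ zero 5 _ = add-offset 1 4 offset1 (add-offset 0 0 offset4 zero∈)
≤4*[2+p]⇒⟨Gens⟩ zero 6 _ = add-offset 1 3 offset3 (add-offset 0 0 offset3 zero∈)
≤4*[2+p]⇒⟨Gens⟩ zero 7 _ = add-offset 1 4 offset3 (add-offset 0 0 offset4 zero∈)
≤4*[2+p]⇒⟨Gens⟩ zero 8 _ = add-offset 1 4 offset4 (add-offset 0 0 offset4 zero∈)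
≤4*[2+p]⇒⟨Gens⟩ zero (suc (suc (suc (suc (suc (suc (suc (suc (suc _)))))))))
  (s≤s (s≤s (s≤s (s≤s (s≤s (s≤s (s≤s (s≤s ()))))))))
≤4*[2+p]⇒⟨Gens⟩ (suc p) 0 _ = add-offset (2 + p) 0 offset0 (≤4*[2+p]⇒⟨Gens⟩ p 0 z≤n)
≤4*[2+p]⇒⟨Gens⟩ (suc p) 1 _ =
  add-offset (2 + p) 1 offset0 (≤4*[2+p]⇒⟨Gens⟩ p 1 (≤3⇒≤4[2+p] (s≤s z≤n)))
≤4*[2+p]⇒⟨Gens⟩ (suc p) 2 _ =
  add-offset (2 + p) 2 offset0 (≤4*[2+p]⇒⟨Gens⟩ p 2 (≤3⇒≤4[2+p] (s≤s (s≤s z≤n))))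
≤4*[2+p]⇒⟨Gens⟩ (suc p) 3 _ =
  add-offset (2 + p) 3 offset0 (≤4*[2+p]⇒⟨Gens⟩ p 3 (≤3⇒≤4[2+p] ≤-refl))
≤4*[2+p]⇒⟨Gens⟩ (suc p) (suc (suc (suc (suc f)))) 4+f≤ =
  add-offset (2 + p) f offset4
    (≤4*[2+p]⇒⟨Gens⟩ p f (+-cancelˡ-≤ 4 f _ (subst (4 + f ≤_) (*-suc 4 (2 + p)) 4+f≤)))

Admissible⇒⟨Gens⟩ : ∀ {m n f} → Admissible n f → ⟨ Gens m ⟩ (n * m + 2 * f)
Admissible⇒⟨Gens⟩ {n = 0} (z≤n , _) = zero∈
Admissible⇒⟨Gens⟩ {n = 1} {0} _ = add-offset 0 0 offset0 zero∈
Admissible⇒⟨Gens⟩ {n = 1} {1} _ = add-offset 0 0 offset1 zero∈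
Admissible⇒⟨Gens⟩ {n = 1} {2} (_ , ≢) = contradiction (refl , refl) ≢
Admissible⇒⟨Gens⟩ {n = 1} {3} _ = add-offset 0 0 offset3 zero∈
Admissible⇒⟨Gens⟩ {n = 1} {4} _ = add-offset 0 0 offset4 zero∈
Admissible⇒⟨Gens⟩ {n = 1} {suc (suc (suc (suc (suc _))))} (s≤s (s≤s (s≤s (s≤s ()))) , _)
Admissible⇒⟨Gens⟩ {n = suc (suc p)} {f} (f≤4n , _) = ≤4*[2+p]⇒⟨Gens⟩ p f f≤4n

Ap⇒not-below : ∀ {m x n f} → Ap ⟨ Gens m ⟩ m x → Admissible n f → n * m + 2 * f + m ≢ x
Ap⇒not-below (_ , ∉) adm eq = ∉ (_ , Admissible⇒⟨Gens⟩ adm , eq)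

≤4*n⇒Admissible-suc : ∀ {n f} → f ≤ 4 * n → Admissible (suc n) f
≤4*n⇒Admissible-suc {n} {f} f≤4n = ≤-trans f≤4n (*-monoʳ-≤ 4 (n≤1+n n)) , not-exceptional
  where
  not-exceptional : ¬ (suc n ≡ 1 × f ≡ 2)
  not-exceptional (n+1≡1 , f≡2) with suc-injective n+1≡1
  ... | refl = contradiction (subst (_≤ 0) f≡2 f≤4n) λ ()

Ap⇒<m : ∀ {m n f} → Admissible n f → Ap ⟨ Gens m ⟩ m (n * m + 2 * f) → f < m
Ap⇒<m {m} {n} {f} (f≤4n , _) ap with m ≤? f
... | no m≰f = ≰⇒> m≰f
... | yes m≤f with m≤n⇒∃[o]m+o≡n m≤f
...   | e , refl =
  contradiction (move-m m n e)
    (Ap⇒not-below ap (≤4*n⇒Admissible-suc {n} (≤-trans (m≤n+m e m) f≤4n)))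
  where
  move-m : ∀ m n e → suc n * m + 2 * e + m ≡ n * m + 2 * (m + e)
  move-m = solve-∀

Ap⇒top-or-exceptional : ∀ {m} n {f} → Admissible n f → Ap ⟨ Gens m ⟩ m (n * m + 2 * f) →
                        4 * n ≤ f + 3 ⊎ (n ≡ 2 × f ≡ 2)
Ap⇒top-or-exceptional zero _ _ = inj₁ z≤n
Ap⇒top-or-exceptional {m} (suc n) {f} _ ap with 4 * suc n ≤? f + 3
... | yes top = inj₁ top
... | no ¬top with (n ≟ 1) ×-dec (f ≟ 2)
...   | yes (refl , refl) = inj₂ (refl , refl)
...   | no ≢ = contradiction (drop-m m n f) (Ap⇒not-below {n = n} ap (f≤4n , ≢))
  where
  f≤4n : f ≤ 4 * n
  f≤4n = +-cancelˡ-≤ 4 f (4 * n) (subst₂ _≤_ (cong suc (+-comm f 3)) (*-suc 4 n) (≰⇒> ¬top))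
  drop-m : ∀ m n f → n * m + 2 * f + m ≡ suc n * m + 2 * f
  drop-m = solve-∀

AperyPair : ℕ → ℕ → ℕ → Set
AperyPair m n f = (4 * n ≤ f + 3 × f < m) ⊎ (n ≡ 2 × f ≡ 2)

Ap⇒AperyPair : ∀ {m n f} → Admissible n f → Ap ⟨ Gens m ⟩ m (n * m + 2 * f) → AperyPair m n f
Ap⇒AperyPair {n = n} adm ap with Ap⇒top-or-exceptional n adm ap
... | inj₁ top         = inj₁ (top , Ap⇒<m adm ap)
... | inj₂ exceptional = inj₂ exceptional

Odd : ℕ → Set
Odd m = ∃[ h ] m ≡ suc (2 * h)

[1+d]*m+2*f≢2*g : ∀ {m} d f {g} → Odd m → g < m → suc d * m + 2 * f ≢ 2 * g
[1+d]*m+2*f≢2*g zero f {g} (h , refl) _ eq = even≢odd g (f + h) (trans (sym eq) (odd-sum h f))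
  where
  odd-sum : ∀ h f → 1 * suc (2 * h) + 2 * f ≡ suc (2 * (f + h))
  odd-sum = solve-∀
[1+d]*m+2*f≢2*g {m} (suc d) f {g} _ g<m eq = <⇒≱ g<m (*-cancelˡ-≤ 2 (subst (2 * m ≤_) eq 2m≤))
  where
  split-2m : ∀ m d f → suc (suc d) * m + 2 * f ≡ 2 * m + (d * m + 2 * f)
  split-2m = solve-∀
  2m≤ : 2 * m ≤ suc (suc d) * m + 2 * f
  2m≤ = subst (2 * m ≤_) (sym (split-2m m d f)) (m≤m+n (2 * m) _)

shorter-sum-impossible : ∀ m n f d g → f ≤ 4 * n → 4 * (suc n + d) ≤ g + 3 →
                         n * m + 2 * f + m ≢ (suc n + d) * m + 2 * g
shorter-sum-impossible m n f d g f≤4n top eq = <⇒≱ 4n<g (≤-trans g≤f f≤4n)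
  where
  shift : ∀ m n f → n * m + 2 * f + m ≡ suc n * m + 2 * f
  shift = solve-∀
  split : ∀ m n d g → (suc n + d) * m + 2 * g ≡ suc n * m + (d * m + 2 * g)
  split = solve-∀
  4[1+n] : ∀ n → suc (4 * n) + 3 ≡ 4 * suc n
  4[1+n] = solve-∀
  2f≡ : 2 * f ≡ d * m + 2 * g
  2f≡ = +-cancelˡ-≡ (suc n * m) _ _ (trans (sym (shift m n f)) (trans eq (split m n d g)))
  g≤f : g ≤ f
  g≤f = *-cancelˡ-≤ 2 (subst (2 * g ≤_) (sym 2f≡) (m≤n+m (2 * g) (d * m)))
  4n<g : 4 * n < g
  4n<g = +-cancelʳ-≤ 3 (suc (4 * n)) g
           (≤-trans (≤-reflexive (4[1+n] n)) (≤-trans (*-monoʳ-≤ 4 (m≤m+n (suc n) d)) top))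

longer-sum-impossible : ∀ {m} j d f {g} → Odd m → g < m →
                        (j + d) * m + 2 * f + m ≢ j * m + 2 * g
longer-sum-impossible {m} j d f odd g<m eq =
  [1+d]*m+2*f≢2*g d f odd g<m (+-cancelˡ-≡ (j * m) _ _ (trans (split m j d f) eq))
  where
  split : ∀ m j d f → j * m + (suc d * m + 2 * f) ≡ (j + d) * m + 2 * f + m
  split = solve-∀

top-band-minimal : ∀ {m} n f j g → Odd m → f ≤ 4 * n → 4 * j ≤ g + 3 → g < m →
                   n * m + 2 * f + m ≢ j * m + 2 * g
top-band-minimal {m} n f j g odd f≤4n top g<m with suc n ≤? j
... | yes n<j with m≤n⇒∃[o]m+o≡n n<j
...   | d , refl = shorter-sum-impossible m n f d g f≤4n top
top-band-minimal n f j g odd f≤4n top g<m | no n≮j with m≤n⇒∃[o]m+o≡n (≤-pred (≰⇒> n≮j))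
...   | d , refl = longer-sum-impossible j d f odd g<m

top-band⇒Ap : ∀ {m n f} → Odd m → Admissible n f → 4 * n ≤ f + 3 → f < m →
              Ap ⟨ Gens m ⟩ m (n * m + 2 * f)
top-band⇒Ap {m} {n = n} {f} odd adm top f<m =
  Admissible⇒⟨Gens⟩ adm , λ (t , t∈ , eq) → not-below (⟨Gens⟩⇒Repr t∈) eq
  where
  not-below : ∀ {t} → Repr m t → t + m ≢ n * m + 2 * f
  not-below (repr n' f' (f'≤4n' , _) refl) = top-band-minimal n' f' n f odd f'≤4n' top f<m

Admissible⇒≢m+4 : ∀ {m n f} → 5 ≤ m → Admissible n f → n * m + 2 * f ≢ m + 4
Admissible⇒≢m+4 {m} {zero} _ (z≤n , _) eq = m+1+n≢0 m (sym eq)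
Admissible⇒≢m+4 {m} {1} {f} _ (_ , ≢) eq =
  ≢ (refl , *-cancelˡ-≡ f 2 2 (+-cancelˡ-≡ m _ _ (trans (cong (_+ 2 * f) (sym (*-identityˡ m))) eq)))
Admissible⇒≢m+4 {m} {suc (suc p)} {f} 5≤m _ eq = <-irrefl refl (begin-strict
  m + 4                     <⟨ +-monoʳ-< m 5≤m ⟩
  m + m                     ≤⟨ +-monoʳ-≤ m (m≤m+n m _) ⟩
  m + (m + (p * m + 2 * f)) ≡⟨ regroup m p f ⟩
  suc (suc p) * m + 2 * f   ≡⟨ eq ⟩
  m + 4                     ∎)
  where
  open ≤-Reasoning
  regroup : ∀ m p f → m + (m + (p * m + 2 * f)) ≡ suc (suc p) * m + 2 * f
  regroup = solve-∀

2m+4∈Ap : ∀ {m} → 5 ≤ m → Ap ⟨ Gens m ⟩ m (2 * m + 2 * 2)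
2m+4∈Ap {m} 5≤m = Admissible⇒⟨Gens⟩ {n = 2} {2} (s≤s (s≤s z≤n) , λ { (() , _) }) ,
                  λ (t , t∈ , eq) → not-below (⟨Gens⟩⇒Repr t∈) eq
  where
  regroup : ∀ m → 2 * m + 2 * 2 ≡ m + 4 + m
  regroup = solve-∀
  not-below : ∀ {t} → Repr m t → t + m ≢ 2 * m + 2 * 2
  not-below (repr _ _ adm refl) eq = Admissible⇒≢m+4 5≤m adm (+-cancelʳ-≡ m _ _ (trans eq (regroup m)))

record AperyRepr (m x : ℕ) : Set where
  constructor apery-repr
  field
    n f        : ℕ
    admissible : Admissible n f
    pair       : AperyPair m n f
    value      : n * m + 2 * f ≡ x

Ap⇔AperyRepr : ∀ {m x} → Odd m → 5 ≤ m → Ap ⟨ Gens m ⟩ m x ⇔ AperyRepr m x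
Ap⇔AperyRepr {m} {x = x} odd 5≤m = mk⇔ to from
  where
  to : Ap ⟨ Gens m ⟩ m x → AperyRepr m x
  to ap@(x∈ , _) with ⟨Gens⟩⇒Repr x∈
  ... | repr n f adm refl = apery-repr n f adm (Ap⇒AperyPair adm ap) refl
  from : AperyRepr m x → Ap ⟨ Gens m ⟩ m x
  from (apery-repr n f adm (inj₁ (top , f<m)) refl) = top-band⇒Ap odd adm top f<m
  from (apery-repr _ _ _ (inj₂ (refl , refl)) refl) = 2m+4∈Ap 5≤m

top-row : ∀ m n f i → f + i ≡ 4 * n → n * m + 2 * f + 2 * i ≡ n * (m + 8)
top-row m n f i f+i≡4n = begin
  n * m + 2 * f + 2 * i ≡⟨ gather m n f i ⟩
  n * m + 2 * (f + i)   ≡⟨ cong (λ s → n * m + 2 * s) f+i≡4n ⟩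
  n * m + 2 * (4 * n)   ≡⟨ spread m n ⟩
  n * (m + 8)           ∎
  where
  open ≡-Reasoning
  gather : ∀ m n f i → n * m + 2 * f + 2 * i ≡ n * m + 2 * (f + i)
  gather = solve-∀
  spread : ∀ m n → n * m + 2 * (4 * n) ≡ n * (m + 8)
  spread = solve-∀

Row : ℕ → ℕ → Set
Row x N = x + 6 ≡ N ⊎ x + 4 ≡ N ⊎ x + 2 ≡ N ⊎ x ≡ N

deficit⇒Row : ∀ {x i N} → i ≤ 3 → x + 2 * i ≡ N → Row x N
deficit⇒Row {i = 0} _ eq = inj₂ (inj₂ (inj₂ (trans (sym (+-identityʳ _)) eq)))
deficit⇒Row {i = 1} _ eq = inj₂ (inj₂ (inj₁ eq))
deficit⇒Row {i = 2} _ eq = inj₂ (inj₁ eq)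
deficit⇒Row {i = 3} _ eq = inj₁ eq
deficit⇒Row {i = suc (suc (suc (suc _)))} (s≤s (s≤s (s≤s ()))) _

Row⇒deficit : ∀ {x N} → Row x N → ∃[ i ] (i ≤ 3 × x + 2 * i ≡ N)
Row⇒deficit (inj₁ eq)               = 3 , ≤-refl , eq
Row⇒deficit (inj₂ (inj₁ eq))        = 2 , s≤s (s≤s z≤n) , eq
Row⇒deficit (inj₂ (inj₂ (inj₁ eq))) = 1 , s≤s z≤n , eq
Row⇒deficit (inj₂ (inj₂ (inj₂ eq))) = 0 , z≤n , trans (+-identityʳ _) eq

AperyList : ℕ → ℕ → Set
AperyList k x = (x ≡ 0 ⊎ x ≡ 4 * k + 9 ⊎ x ≡ 4 * k + 13 ⊎ x ≡ 4 * k + 15 ⊎ x ≡ 2 * (4 * k + 9))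
              ⊎ (∃[ j ] ((2 ≤ j × j ≤ k + 1) × Row x (j * (4 * k + 15))))
              ⊎ (x + 6 ≡ (k + 2) * (4 * k + 15) ⊎ x + 4 ≡ (k + 2) * (4 * k + 15))

4k+7+8≡4k+15 : ∀ k → 4 * k + 7 + 8 ≡ 4 * k + 15
4k+7+8≡4k+15 k = +-assoc (4 * k) 7 8

<4k+7⇒≤4k+6 : ∀ {k f} → f < 4 * k + 7 → f ≤ 4 * k + 6
<4k+7⇒≤4k+6 {k} {f} f<m = ≤-pred (subst (suc f ≤_) (+-suc (4 * k) 6) f<m)

<7⇒<4k+7 : ∀ {k f} → f < 7 → f < 4 * k + 7
<7⇒<4k+7 {k} f<7 = ≤-trans f<7 (m≤n+m 7 (4 * k))

single-generator : ∀ k c → 1 * (4 * k + 7) + 2 * c ≡ 4 * k + (7 + 2 * c)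
single-generator = solve-∀

2[4k+7]+4≡2[4k+9] : ∀ k → 2 * (4 * k + 7) + 2 * 2 ≡ 2 * (4 * k + 9)
2[4k+7]+4≡2[4k+9] = solve-∀

last-summand-count : ∀ k n {f i} → ¬ (n ≤ k + 1) → i ≤ 3 → f + i ≡ 4 * n → f < 4 * k + 7 →
                     n ≡ k + 2
last-summand-count k n {f} {i} n≰k+1 i≤3 f+i≡4n f<m = ≤-antisym n≤k+2 k+2≤n
  where
  open ≤-Reasoning
  k+2≤n : k + 2 ≤ n
  k+2≤n = subst (_≤ n) (sym (+-suc k 1)) (≰⇒> n≰k+1)
  bound : ∀ k → 4 * k + 6 + 3 < 4 * (k + 3)
  bound k = begin-strict
    4 * k + 6 + 3 ≡⟨ +-assoc (4 * k) 6 3 ⟩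
    4 * k + 9     <⟨ +-monoʳ-< (4 * k) (m<m+n 9 z<s) ⟩
    4 * k + 12    ≡⟨ *-distribˡ-+ 4 k 3 ⟨
    4 * (k + 3)   ∎
  n≤k+2 : n ≤ k + 2
  n≤k+2 = ≤-pred (subst (n <_) (+-suc k 2) (*-cancelˡ-< 4 n (k + 3) (begin-strict
    4 * n         ≡⟨ f+i≡4n ⟨
    f + i         ≤⟨ +-mono-≤ (<4k+7⇒≤4k+6 {k} f<m) i≤3 ⟩
    4 * k + 6 + 3 <⟨ bound k ⟩
    4 * (k + 3)   ∎)))

last-row-deficit : ∀ k {f i} → f + i ≡ 4 * (k + 2) → f < 4 * k + 7 → 2 ≤ i
last-row-deficit k {f} {i} f+i≡ f<m = +-cancelˡ-≤ (4 * k + 6) 2 i (begin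
  4 * k + 6 + 2 ≡⟨ 4[k+2] k ⟨
  4 * (k + 2)   ≡⟨ f+i≡ ⟨
  f + i         ≤⟨ +-monoˡ-≤ i (<4k+7⇒≤4k+6 {k} f<m) ⟩
  4 * k + 6 + i ∎)
  where
  open ≤-Reasoning
  4[k+2] : ∀ k → 4 * (k + 2) ≡ 4 * k + 6 + 2
  4[k+2] = solve-∀

last-row : ∀ {x i N} → 2 ≤ i → i ≤ 3 → x + 2 * i ≡ N → x + 6 ≡ N ⊎ x + 4 ≡ N
last-row {i = 1} (s≤s ()) _ _
last-row {i = 2} _ _ eq = inj₂ eq
last-row {i = 3} _ _ eq = inj₁ eq
last-row {i = suc (suc (suc (suc _)))} _ (s≤s (s≤s (s≤s ()))) _

deep-top-band→AperyList : ∀ k n f i → 2 ≤ n → i ≤ 3 → f + i ≡ 4 * n → f < 4 * k + 7 →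
                          AperyList k (n * (4 * k + 7) + 2 * f)
deep-top-band→AperyList k n f i 2≤n i≤3 f+i≡4n f<m with n ≤? k + 1
... | yes n≤k+1 = inj₂ (inj₁ (n , (2≤n , n≤k+1) , deficit⇒Row i≤3 row))
  where
  row = trans (top-row (4 * k + 7) n f i f+i≡4n) (cong (n *_) (4k+7+8≡4k+15 k))
... | no n≰k+1 with last-summand-count k n n≰k+1 i≤3 f+i≡4n f<m
...   | refl = inj₂ (inj₂ (last-row (last-row-deficit k f+i≡4n f<m) i≤3 row))
  where
  row = trans (top-row (4 * k + 7) (k + 2) f i f+i≡4n) (cong ((k + 2) *_) (4k+7+8≡4k+15 k))

top-band→AperyList : ∀ k n f → Admissible n f → 4 * n ≤ f + 3 → f < 4 * k + 7 →
                     AperyList k (n * (4 * k + 7) + 2 * f)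
top-band→AperyList k 0 .0 (z≤n , _) _ _ = inj₁ (inj₁ refl)
top-band→AperyList k 1 0 _ (s≤s (s≤s (s≤s ()))) _
top-band→AperyList k 1 1 _ _ _ = inj₁ (inj₂ (inj₁ (single-generator k 1)))
top-band→AperyList k 1 2 (_ , ≢) _ _ = contradiction (refl , refl) ≢
top-band→AperyList k 1 3 _ _ _ = inj₁ (inj₂ (inj₂ (inj₁ (single-generator k 3))))
top-band→AperyList k 1 4 _ _ _ = inj₁ (inj₂ (inj₂ (inj₂ (inj₁ (single-generator k 4)))))
top-band→AperyList k 1 (suc (suc (suc (suc (suc _))))) (s≤s (s≤s (s≤s (s≤s ()))) , _) _ _
top-band→AperyList k n@(suc (suc _)) f (f≤4n , _) top f<m with m≤n⇒∃[o]m+o≡n f≤4n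
... | i , f+i≡4n =
  deep-top-band→AperyList k n f i (s≤s (s≤s z≤n)) i≤3 f+i≡4n f<m
  where
  i≤3 : i ≤ 3
  i≤3 = +-cancelˡ-≤ f i 3 (subst (_≤ f + 3) (sym f+i≡4n) top)

AperyRepr→AperyList : ∀ k {x} → AperyRepr (4 * k + 7) x → AperyList k x
AperyRepr→AperyList k (apery-repr n f adm (inj₁ (top , f<m)) refl) =
  top-band→AperyList k n f adm top f<m
AperyRepr→AperyList k (apery-repr _ _ _ (inj₂ (refl , refl)) refl) =
  inj₁ (inj₂ (inj₂ (inj₂ (inj₂ (2[4k+7]+4≡2[4k+9] k)))))

top-band→AperyRepr : ∀ {m j f i x} → 2 ≤ j → i ≤ 3 → f + i ≡ 4 * j → f < m →
                     x + 2 * i ≡ j * (m + 8) → AperyRepr m x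
top-band→AperyRepr {m} {j} {f} {i} {x} 2≤j i≤3 f+i≡4j f<m x+2i≡ =
  apery-repr j f (f≤4j , not-exceptional) (inj₁ (4j≤f+3 , f<m))
    (+-cancelʳ-≡ (2 * i) _ _ (trans (top-row m j f i f+i≡4j) (sym x+2i≡)))
  where
  f≤4j : f ≤ 4 * j
  f≤4j = subst (f ≤_) f+i≡4j (m≤m+n f i)
  4j≤f+3 : 4 * j ≤ f + 3
  4j≤f+3 = subst (_≤ f + 3) f+i≡4j (+-monoʳ-≤ f i≤3)
  not-exceptional : ¬ (j ≡ 1 × f ≡ 2)
  not-exceptional (j≡1 , _) = contradiction (subst (2 ≤_) j≡1 2≤j) λ { (s≤s ()) }

middle-row→AperyRepr : ∀ k {j x} → 2 ≤ j → j ≤ k + 1 → Row x (j * (4 * k + 15)) →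
                       AperyRepr (4 * k + 7) x
middle-row→AperyRepr k {j} 2≤j j≤k+1 row with Row⇒deficit row
... | i , i≤3 , x+2i≡ =
  top-band→AperyRepr 2≤j i≤3 (m∸n+n≡m i≤4j) f<m
    (trans x+2i≡ (cong (j *_) (sym (4k+7+8≡4k+15 k))))
  where
  open ≤-Reasoning
  i≤4j : i ≤ 4 * j
  i≤4j = ≤-trans i≤3 (≤-trans (s≤s (s≤s (s≤s z≤n))) (*-monoʳ-≤ 4 2≤j))
  f<m : 4 * j ∸ i < 4 * k + 7
  f<m = begin-strict
    4 * j ∸ i   ≤⟨ m∸n≤m (4 * j) i ⟩
    4 * j       ≤⟨ *-monoʳ-≤ 4 j≤k+1 ⟩
    4 * (k + 1) ≡⟨ *-distribˡ-+ 4 k 1 ⟩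
    4 * k + 4   <⟨ +-monoʳ-< (4 * k) (s≤s (s≤s (s≤s (s≤s (s≤s z≤n))))) ⟩
    4 * k + 7   ∎

last-row→AperyRepr : ∀ k {x} → x + 6 ≡ (k + 2) * (4 * k + 15) ⊎ x + 4 ≡ (k + 2) * (4 * k + 15) →
                     AperyRepr (4 * k + 7) x
last-row→AperyRepr k (inj₁ x+6≡) =
  top-band→AperyRepr (m≤n+m 2 k) ≤-refl (4k+5+3 k) (+-monoʳ-< (4 * k) (m<m+n 5 z<s))
    (trans x+6≡ (cong ((k + 2) *_) (sym (4k+7+8≡4k+15 k))))
  where
  4k+5+3 : ∀ k → 4 * k + 5 + 3 ≡ 4 * (k + 2)
  4k+5+3 = solve-∀
last-row→AperyRepr k (inj₂ x+4≡) =
  top-band→AperyRepr (m≤n+m 2 k) (s≤s (s≤s z≤n)) (4k+6+2 k) (+-monoʳ-< (4 * k) ≤-refl)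
    (trans x+4≡ (cong ((k + 2) *_) (sym (4k+7+8≡4k+15 k))))
  where
  4k+6+2 : ∀ k → 4 * k + 6 + 2 ≡ 4 * (k + 2)
  4k+6+2 = solve-∀

generator→AperyRepr : ∀ k {c} → Offset c → 1 ≤ c →
                      AperyRepr (4 * k + 7) (4 * k + (7 + 2 * c))
generator→AperyRepr k {c} c∈ 1≤c =
  apery-repr 1 c (Offset⇒≤4 c∈ , λ (_ , c≡2) → Offset⇒≢2 c∈ c≡2) (inj₁ (+-monoˡ-≤ 3 1≤c , c<m))
    (single-generator k c)
  where
  c<m : c < 4 * k + 7
  c<m = <7⇒<4k+7 {k} (s≤s (≤-trans (Offset⇒≤4 c∈) (m≤m+n 4 2)))

AperyList→AperyRepr : ∀ k {x} → AperyList k x → AperyRepr (4 * k + 7) x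
AperyList→AperyRepr k (inj₁ (inj₁ refl)) =
  apery-repr 0 0 (z≤n , λ ()) (inj₁ (z≤n , <7⇒<4k+7 {k} (s≤s z≤n))) refl
AperyList→AperyRepr k (inj₁ (inj₂ (inj₁ refl)))               = generator→AperyRepr k offset1 ≤-refl
AperyList→AperyRepr k (inj₁ (inj₂ (inj₂ (inj₁ refl))))        = generator→AperyRepr k offset3 (s≤s z≤n)
AperyList→AperyRepr k (inj₁ (inj₂ (inj₂ (inj₂ (inj₁ refl))))) = generator→AperyRepr k offset4 (s≤s z≤n)
AperyList→AperyRepr k (inj₁ (inj₂ (inj₂ (inj₂ (inj₂ refl))))) =
  apery-repr 2 2 (s≤s (s≤s z≤n) , λ { (() , _) }) (inj₂ (refl , refl)) (2[4k+7]+4≡2[4k+9] k)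
AperyList→AperyRepr k (inj₂ (inj₁ (j , (2≤j , j≤k+1) , row))) = middle-row→AperyRepr k 2≤j j≤k+1 row
AperyList→AperyRepr k (inj₂ (inj₂ last))                      = last-row→AperyRepr k last

Generatorₖ : ℕ → ℕ → Set
Generatorₖ k g = g ≡ 4 * k + 7 ⊎ g ≡ 4 * k + 9 ⊎ g ≡ 4 * k + 13 ⊎ g ≡ 4 * k + 15

Generatorₖ⇒Gens : ∀ k {g} → Generatorₖ k g → Gens (4 * k + 7) g
Generatorₖ⇒Gens k (inj₁ refl)               = subst (Gens _) (+-assoc (4 * k) 7 0) (generator offset0)
Generatorₖ⇒Gens k (inj₂ (inj₁ refl))        = subst (Gens _) (+-assoc (4 * k) 7 2) (generator offset1)
Generatorₖ⇒Gens k (inj₂ (inj₂ (inj₁ refl))) = subst (Gens _) (+-assoc (4 * k) 7 6) (generator offset3)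
Generatorₖ⇒Gens k (inj₂ (inj₂ (inj₂ refl))) = subst (Gens _) (+-assoc (4 * k) 7 8) (generator offset4)

Gens⇒Generatorₖ : ∀ k {g} → Gens (4 * k + 7) g → Generatorₖ k g
Gens⇒Generatorₖ k (generator offset0) = inj₁ (+-assoc (4 * k) 7 0)
Gens⇒Generatorₖ k (generator offset1) = inj₂ (inj₁ (+-assoc (4 * k) 7 2))
Gens⇒Generatorₖ k (generator offset3) = inj₂ (inj₂ (inj₁ (+-assoc (4 * k) 7 6)))
Gens⇒Generatorₖ k (generator offset4) = inj₂ (inj₂ (inj₂ (+-assoc (4 * k) 7 8)))

corollary31 : (k : ℕ) → (x : ℕ) →
    Ap ⟨ (λ g → g ≡ 4 * k + 7 ⊎ g ≡ 4 * k + 9 ⊎ g ≡ 4 * k + 13 ⊎ g ≡ 4 * k + 15) ⟩ (4 * k + 7) x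
      ⇔ ((x ≡ 0 ⊎ x ≡ 4 * k + 9 ⊎ x ≡ 4 * k + 13 ⊎ x ≡ 4 * k + 15 ⊎ x ≡ 2 * (4 * k + 9))
        ⊎ (∃[ j ] ((2 ≤ j × j ≤ k + 1)
              × (x + 6 ≡ j * (4 * k + 15) ⊎ x + 4 ≡ j * (4 * k + 15)
                 ⊎ x + 2 ≡ j * (4 * k + 15) ⊎ x ≡ j * (4 * k + 15))))
        ⊎ (x + 6 ≡ (k + 2) * (4 * k + 15) ⊎ x + 4 ≡ (k + 2) * (4 * k + 15)))
corollary31 k x =
  ⇔-trans (Ap-cong (Generatorₖ⇒Gens k) (Gens⇒Generatorₖ k))
    (⇔-trans (Ap⇔AperyRepr (2 * k + 3 , odd k) 7≤m)
      (mk⇔ (AperyRepr→AperyList k) (AperyList→AperyRepr k)))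
  where
  odd : ∀ k → 4 * k + 7 ≡ suc (2 * (2 * k + 3))
  odd = solve-∀
  7≤m : 5 ≤ 4 * k + 7
  7≤m = ≤-trans (s≤s (s≤s (s≤s (s≤s (s≤s z≤n))))) (m≤n+m 7 (4 * k))
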